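{- Let $P=v_1v_2\dots v_n$ be a path with $\|P\|=n-1$ edges. (1) If $\|P\|\geq 5$, then $P$ has a proper orientation with $d^-(v_1)=0$, $d^-(v_2)=1$, $d^-(v_{n-2})=0$, $d^-(v_{n-1})=2$ and $d^-(v_n)=0$. (2) If $\|P\|=4$, then $P$ has a proper orientation with in-degrees $d^-(v_1),\dots,d^-(v_5)$ equal to $0,1,2,1,0$ respectively, and also a proper orientation with in-degrees $0,2,0,2,0$ respectively. (3) If $\|P\|=3$, then $P$ has a proper orientation with $d^-(v_1)=0$, $d^-(v_2)=1$, $d^-(v_3)=2$ and $d^-(v_4)=0$.
   Context: An orientation of a graph is obtained by replacing each edge by one of the two possible arcs on its end-vertices; $d^-(v)$ denotes the in-degree of $v$ in the orientation. An orientation is proper if adjacent vertices have different in-degrees. For a path $P$, $\|P\|$ denotes its number of edges. -}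

module Defs where

open import Data.Nat using (ℕ; zero; suc; _+_)
open import Data.Bool using (Bool; true; false)
open import Data.Fin using (Fin; zero; suc; inject₁)
open import Data.Product using (_×_)
open import Relation.Binary.PropositionalEquality using (_≡_; _≢_)

-- The path P with m edges has vertices 0,1,…,m (Fin (suc m)); vertex i is
-- the paper's v_{i+1}.  Edge e : Fin m joins vertices (inject₁ e) and (suc e).

-- An orientation of the path: for each edge, an orientation choice.
-- forward  : arc inject₁ e → suc e   (head is suc e)
-- backward : arc suc e → inject₁ e   (head is inject₁ e)
data Dir : Set where
  forward backward : Dir

Orientation : ℕ → Set
Orientation m = Fin m → Dir

private
  isFwd : Dir → ℕ
  isFwd forward = 1
  isFwd backward = 0

  isBwd : Dir → ℕ
  isBwd forward = 0
  isBwd backward = 1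

fromLeft : {m : ℕ} → Orientation m → Fin (suc m) → ℕ
fromLeft o zero = 0
fromLeft o (suc e) = isFwd (o e)

fromRight : {m : ℕ} → Orientation m → Fin (suc m) → ℕ
fromRight {zero} o zero = 0
fromRight {suc m} o zero = isBwd (o zero)
fromRight {suc m} o (suc v) = fromRight (λ e → o (suc e)) v

indeg : {m : ℕ} → Orientation m → Fin (suc m) → ℕ
indeg o v = fromLeft o v + fromRight o v

Proper : {m : ℕ} → Orientation m → Set
Proper {m} o = (e : Fin m) → indeg o (inject₁ e) ≢ indeg o (suc e)

-- For at least five edges, take two forward edges (in-degrees 0, 1, 2) followed by
-- a zigzag whose in-degrees from its second vertex on alternate 0, 2, 0, 2, …,
-- with a single vertex of in-degree 1 inserted when the parity of the length
-- requires it, so that it ends in 0, 2, 0.  Prepending an edge to an orientation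
-- changes only the in-degree of the old first vertex, so properness is carried
-- through the recursion on every edge but the first, which is checked directly.
module Submission where

open import Defs
open import Data.Nat using (ℕ; suc; _+_; _≟_)
open import Data.Fin using (Fin; zero; suc; fromℕ; inject₁)
open import Data.Fin.Properties using (all?)
open import Data.Product using (Σ; _×_; _,_)
open import Relation.Nullary.Decidable using (Dec; ¬?; from-yes)
open import Relation.Binary.PropositionalEquality using (_≡_; _≢_; refl; sym)

infixr 5 _∷_

[] : Orientation 0
[] ()

_∷_ : {m : ℕ} → Dir → Orientation m → Orientation (suc m)
(d ∷ o) zero = d
(d ∷ o) (suc e) = o e

EdgeProper : {m : ℕ} → Orientation m → Fin m → Set
EdgeProper o e = indeg o (inject₁ e) ≢ indeg o (suc e)

edgeProper? : {m : ℕ} (o : Orientation m) (e : Fin m) → Dec (EdgeProper o e)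
edgeProper? o e = ¬? (indeg o (inject₁ e) ≟ indeg o (suc e))

proper? : {m : ℕ} (o : Orientation m) → Dec (Proper o)
proper? o = all? (edgeProper? o)

ProperExceptFirst : {m : ℕ} → Orientation (suc m) → Set
ProperExceptFirst o = ∀ e → EdgeProper o (suc e)

properExceptFirst? : {m : ℕ} (o : Orientation (suc m)) → Dec (ProperExceptFirst o)
properExceptFirst? o = all? (λ e → edgeProper? o (suc e))

proper-from-first : {m : ℕ} (o : Orientation (suc m)) →
  EdgeProper o zero → ProperExceptFirst o → Proper o
proper-from-first o first rest zero = first
proper-from-first o first rest (suc e) = rest e

∷-properExceptFirst : {m : ℕ} (d : Dir) (o : Orientation (suc m)) →
  EdgeProper (d ∷ o) (suc zero) → ProperExceptFirst o → ProperExceptFirst (d ∷ o)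
∷-properExceptFirst d o second rest zero = second
∷-properExceptFirst d o second rest (suc e) = rest e

zigzagTail : (k : ℕ) → Orientation (2 + k)
zigzagTail 0 = forward ∷ backward ∷ []
zigzagTail 1 = backward ∷ forward ∷ backward ∷ []
zigzagTail (suc (suc k)) = forward ∷ backward ∷ zigzagTail k

-- Leading with a backward edge makes indeg (zigzag k) zero ≡ 1 hold definitionally.
zigzag : (k : ℕ) → Orientation (3 + k)
zigzag k = backward ∷ zigzagTail k

indeg-zigzag-one≢2 : (k : ℕ) → indeg (zigzag k) (suc zero) ≢ 2
indeg-zigzag-one≢2 0 ()
indeg-zigzag-one≢2 1 ()
indeg-zigzag-one≢2 (suc (suc k)) ()

indeg-zigzag-end : (k : ℕ) →
  indeg (zigzag k) (inject₁ (inject₁ (fromℕ (1 + k)))) ≡ 0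
  × indeg (zigzag k) (inject₁ (fromℕ (2 + k))) ≡ 2
  × indeg (zigzag k) (fromℕ (3 + k)) ≡ 0
indeg-zigzag-end 0 = refl , refl , refl
indeg-zigzag-end 1 = refl , refl , refl
indeg-zigzag-end (suc (suc k)) = indeg-zigzag-end k

forward∷zigzag-properExceptFirst : (k : ℕ) → ProperExceptFirst (zigzag k) →
  ProperExceptFirst (forward ∷ zigzag k)
forward∷zigzag-properExceptFirst k =
  ∷-properExceptFirst forward (zigzag k) (λ eq → indeg-zigzag-one≢2 k (sym eq))

zigzag-properExceptFirst : (k : ℕ) → ProperExceptFirst (zigzag k)
zigzag-properExceptFirst 0 = from-yes (properExceptFirst? (zigzag 0))
zigzag-properExceptFirst 1 = from-yes (properExceptFirst? (zigzag 1))
zigzag-properExceptFirst (suc (suc k)) =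
  ∷-properExceptFirst backward (forward ∷ zigzag k) (λ ())
    (forward∷zigzag-properExceptFirst k (zigzag-properExceptFirst k))

longPath : (k : ℕ) → Orientation (5 + k)
longPath k = forward ∷ forward ∷ zigzag k

longPath-proper : (k : ℕ) → Proper (longPath k)
longPath-proper k =
  proper-from-first (longPath k) (λ ())
    (∷-properExceptFirst forward (forward ∷ zigzag k) (λ ())
      (forward∷zigzag-properExceptFirst k (zigzag-properExceptFirst k)))

rising : Orientation 4
rising = forward ∷ forward ∷ backward ∷ backward ∷ []

alternating : Orientation 4
alternating = forward ∷ backward ∷ forward ∷ backward ∷ []

rising₃ : Orientation 3
rising₃ = forward ∷ forward ∷ backward ∷ []

lemma1 :
    ((k : ℕ) →
      Σ (Orientation (5 + k)) λ o → Proper o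
        × indeg o zero ≡ 0
        × indeg o (suc zero) ≡ 1
        × indeg o (inject₁ (inject₁ (fromℕ (3 + k)))) ≡ 0
        × indeg o (inject₁ (fromℕ (4 + k))) ≡ 2
        × indeg o (fromℕ (5 + k)) ≡ 0)
    × (Σ (Orientation 4) λ o → Proper o
        × indeg o zero ≡ 0 × indeg o (suc zero) ≡ 1 × indeg o (suc (suc zero)) ≡ 2
        × indeg o (suc (suc (suc zero))) ≡ 1 × indeg o (suc (suc (suc (suc zero)))) ≡ 0)
    × (Σ (Orientation 4) λ o → Proper o
        × indeg o zero ≡ 0 × indeg o (suc zero) ≡ 2 × indeg o (suc (suc zero)) ≡ 0
        × indeg o (suc (suc (suc zero))) ≡ 2 × indeg o (suc (suc (suc (suc zero)))) ≡ 0)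
    × (Σ (Orientation 3) λ o → Proper o
        × indeg o zero ≡ 0 × indeg o (suc zero) ≡ 1 × indeg o (suc (suc zero)) ≡ 2
        × indeg o (suc (suc (suc zero))) ≡ 0)
lemma1 =
    (λ k → longPath k , longPath-proper k , refl , refl , indeg-zigzag-end k)
  , (rising , from-yes (proper? rising) , refl , refl , refl , refl , refl)
  , (alternating , from-yes (proper? alternating) , refl , refl , refl , refl , refl)
  , (rising₃ , from-yes (proper? rising₃) , refl , refl , refl , refl)
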